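{- Let $G=(F,V,E)\in\mathbb{G}(n,k,m)$. For a set of checks $F_{\rm b}\subseteq F$, let $G_{\rm b}=(F_{\rm b},V_{\rm b},E_{\rm b})$ be the subgraph induced by $F_{\rm b}$, and let $G_{\rm p}=(F_{\rm p},V_{\rm p},E_{\rm p})$ be the subgraph of $G$ induced by the pair $(F_{\rm p}\equiv F\setminus F_{\rm b},\ V_{\rm p}\equiv V\setminus V_{\rm b})$. Assume: $G_{\rm p}$ is peelable; $G_{\rm b}$ is rigid; and every $a\in F_{\rm p}$ has at least two neighbours in $V_{\rm p}$. Then $G_{\rm b}$ is the backbone of $G$ (and $G_{\rm p}$ is its periphery).
   Context: $\mathbb{G}(n,k,m)$: bipartite factor graphs with $n$ labeled variables, $m$ labeled checks each of degree exactly $k$, no multiple edges. The subgraph induced by a set of checks $F_0$ consists of $F_0$, all variables adjacent to $F_0$, and the edges between them; the subgraph induced by a pair $(F_0,V_0)$ consists of $F_0$, $V_0$ and all edges of $G$ between them. The $2$-core of a graph is its maximal subgraph induced by a set of checks in which every variable has degree $\ge2$. Backbone augmentation from an initial check-induced subgraph: repeatedly add all checks not in the current subgraph that have at most one neighbour outside it, together with their edges and neighbours, until no such check exists. The backbone of a graph is the output of backbone augmentation started from its $2$-core; its periphery is the subgraph induced by the checks and variables not in the backbone. A graph is rigid if its backbone is the whole graph. Synchronous peeling repeatedly deletes (in rounds) all variables of degree $\le1$, all checks adjacent to them and the edges incident to those checks; a graph is peelable if this ends in the empty graph. -}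

module Defs where

open import Data.Nat using (ℕ; zero; suc; _+_; _≤_; _≤ᵇ_; _<ᵇ_)
open import Data.Fin using (Fin; zero; suc)
open import Data.Bool using (Bool; true; false; _∧_; _∨_; not; if_then_else_)
open import Data.Product using (Σ; _×_; _,_; proj₁; proj₂)
open import Function using (_∘_)
open import Relation.Binary.PropositionalEquality using (_≡_)

FSet : ℕ → Set
FSet n = Fin n → Bool

count : ∀ {n} → FSet n → ℕ
count {zero}  f = 0
count {suc n} f = (if f zero then 1 else 0) + count (f ∘ suc)

anyF : ∀ {n} → FSet n → Bool
anyF f = 0 <ᵇ count f

full : ∀ {n} → FSet n
full _ = true

_≐_ : ∀ {n} → FSet n → FSet n → Set
S ≐ T = ∀ x → S x ≡ T x

_⊆_ : ∀ {n} → FSet n → FSet n → Set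
S ⊆ T = ∀ x → S x ≡ true → T x ≡ true

iter : ∀ {A : Set} → (A → A) → ℕ → A → A
iter f zero    x = x
iter f (suc t) x = f (iter f t x)

-- G(n,k,m): n labelled variables (Fin n), m labelled checks (Fin m),
-- adjacency given as a relation (hence no multiple edges),
-- every check has degree exactly k.
record FactorGraph (n k m : ℕ) : Set where
  field
    adj    : Fin m → Fin n → Bool
    degree : ∀ a → count (adj a) ≡ k

-- All subgraphs below are subgraphs of a fixed G induced by a pair (Fs , Vs)
-- (check set, variable set), with all edges of G between them.
-- The whole graph G is the pair (full , full).
module _ {n k m : ℕ} (G : FactorGraph n k m) where
  open FactorGraph G

  nbr : FSet m → FSet n
  nbr S v = anyF (λ a → S a ∧ adj a v)

  vdeg : FSet m → FSet n → Fin n → ℕ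
  vdeg Fs Vs v = count (λ a → Fs a ∧ adj a v)

  indVars : FSet n → FSet m → FSet n
  indVars Vs C v = Vs v ∧ nbr C v

  CoreLike : FSet m → FSet n → FSet m → Set
  CoreLike Fs Vs C =
    (C ⊆ Fs) × (∀ v → indVars Vs C v ≡ true → 2 ≤ vdeg C (indVars Vs C) v)

  IsTwoCore : FSet m → FSet n → FSet m → Set
  IsTwoCore Fs Vs C =
    CoreLike Fs Vs C × (∀ C' → CoreLike Fs Vs C' → C ⊆ C' → C' ≐ C)

  eligible : FSet m → FSet n → FSet m → Fin m → Bool
  eligible Fs Vs S a =
    Fs a ∧ not (S a) ∧ (count (λ v → Vs v ∧ adj a v ∧ not (indVars Vs S v)) ≤ᵇ 1)

  augStep : FSet m → FSet n → FSet m → FSet m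
  augStep Fs Vs S a = S a ∨ eligible Fs Vs S a

  AugOutput : FSet m → FSet n → FSet m → FSet m → Set
  AugOutput Fs Vs S T =
    Σ ℕ λ t → (iter (augStep Fs Vs) t S ≐ T) × (∀ a → eligible Fs Vs T a ≡ false)

  IsBackbone : FSet m → FSet n → FSet m → FSet n → Set
  IsBackbone Fs Vs Fb' Vb' =
    Σ (FSet m) λ C → Σ (FSet m) λ B →
      IsTwoCore Fs Vs C × AugOutput Fs Vs C B × (B ≐ Fb') × (indVars Vs B ≐ Vb')

  Rigid : FSet m → FSet n → Set
  Rigid Fs Vs = IsBackbone Fs Vs Fs Vs

  lowVar : FSet m → FSet n → FSet n
  lowVar F' V' v = V' v ∧ (vdeg F' V' v ≤ᵇ 1)

  peelStep : FSet m × FSet n → FSet m × FSet n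
  peelStep (F' , V') =
    (λ a → F' a ∧ not (anyF (λ v → lowVar F' V' v ∧ adj a v))) ,
    (λ v → V' v ∧ not (lowVar F' V' v))

  Peelable : FSet m → FSet n → Set
  Peelable Fs Vs =
    Σ ℕ λ t → ((∀ a → proj₁ (iter peelStep t (Fs , Vs)) a ≡ false)
             × (∀ v → proj₂ (iter peelStep t (Fs , Vs)) v ≡ false))

module Submission where

-- Write Gb for the subgraph induced by Fb and Gp for the pair
-- (F ∖ Fb , V ∖ Vb).  Three facts about G give the theorem.
--   (1) Peeling never deletes a check lying in a "dense" check set (one in which
--       every touched variable has at least two neighbours), as long as the
--       variables around it are not adjacent to checks outside the peeled
--       graph.  Since Gp is peelable, every dense check set of G lies inside
--       Fb; hence the 2-core of Gb is also the 2-core of G.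
--   (2) Starting from any check set inside Fb, backbone augmentation in G and
--       in Gb add exactly the same checks: a check of Fb sees only variables of
--       Vb, and a check outside Fb has two neighbours outside Vb, so it is
--       never eligible in G.
--   (3) Once everything of Fb has been added, no check of G is eligible.
-- Rigidity of Gb says augmentation in Gb from its 2-core reaches Fb, so by
-- (1)-(3) augmentation in G from the 2-core of G reaches Fb and stops there.

open import Defs
open import Data.Nat using (ℕ; _≤_)
open import Data.Bool using (Bool; true; not; _∧_)
open import Data.Fin using (Fin)
open import Function using (_∘_)
open import Relation.Binary.PropositionalEquality using (_≡_)

open import Data.Nat using (zero; suc; z≤n; s≤s; _≤ᵇ_; _<ᵇ_)
open import Data.Nat.Properties using (≤-trans; ≤-antisym; m≤n⇒m≤1+n)
open import Data.Bool using (false; _∨_)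
open import Data.Bool.Properties using (∧-zeroʳ; ∧-conicalˡ; ∧-conicalʳ; not-injective)
open import Data.Fin using (zero; suc)
open import Data.Product using (_,_; proj₁; proj₂)
open import Relation.Binary.PropositionalEquality
  using (refl; sym; trans; cong; cong₂; module ≡-Reasoning)

contraposition : ∀ {b c : Bool} → (b ≡ true → c ≡ true) → c ≡ false → b ≡ false
contraposition {false} _ _ = refl
contraposition {true}  f c≡false with () ← trans (sym (f refl)) c≡false

≤ᵇ1-false : ∀ {c} → 2 ≤ c → (c ≤ᵇ 1) ≡ false
≤ᵇ1-false (s≤s (s≤s _)) = refl

count-mono : ∀ {n} {f g : FSet n} → f ⊆ g → count f ≤ count g
count-mono {zero}          _   = z≤n
count-mono {suc n} {f} {g} f⊆g with f zero in fz | g zero in gz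
... | true  | true  = s≤s (count-mono (f⊆g ∘ suc))
... | true  | false with () ← trans (sym (f⊆g zero fz)) gz
... | false | true  = m≤n⇒m≤1+n (count-mono (f⊆g ∘ suc))
... | false | false = count-mono (f⊆g ∘ suc)

count-cong : ∀ {n} {f g : FSet n} → f ≐ g → count f ≡ count g
count-cong f≐g = ≤-antisym (count-mono (λ x p → trans (sym (f≐g x)) p))
                           (count-mono (λ x p → trans (f≐g x) p))

count-positive : ∀ {n} (f : FSet n) x → f x ≡ true → 1 ≤ count f
count-positive {suc n} f zero    fx with f zero
... | true = s≤s z≤n
count-positive {suc n} f (suc x) fx with f zero
... | true  = s≤s z≤n
... | false = count-positive (f ∘ suc) x fx

count-empty : ∀ {n} (f : FSet n) → (∀ x → f x ≡ false) → count f ≡ 0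
count-empty {zero}  f _     = refl
count-empty {suc n} f empty rewrite empty zero = count-empty (f ∘ suc) (empty ∘ suc)

anyF-witness : ∀ {n} (f : FSet n) x → f x ≡ true → anyF f ≡ true
anyF-witness f x fx with count f | count-positive f x fx
... | suc _ | _ = refl

anyF-mono : ∀ {n} {f g : FSet n} → f ⊆ g → anyF f ≡ true → anyF g ≡ true
anyF-mono {f = f} {g} f⊆g p with count f | count g | count-mono f⊆g
... | zero  | _     | _  with () ← p
... | suc _ | zero  | ()
... | suc _ | suc _ | _  = refl

anyF-cong : ∀ {n} {f g : FSet n} → f ≐ g → anyF f ≡ anyF g
anyF-cong f≐g = cong (0 <ᵇ_) (count-cong f≐g)

anyF-empty : ∀ {n} (f : FSet n) → (∀ x → f x ≡ false) → anyF f ≡ false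
anyF-empty f empty rewrite count-empty f empty = refl

module _ {n k m : ℕ} (G : FactorGraph n k m) where
  open FactorGraph G

  nbr-witness : ∀ S a v → S a ≡ true → adj a v ≡ true → nbr G S v ≡ true
  nbr-witness S a v Sa e = anyF-witness (λ b → S b ∧ adj b v) a (cong₂ _∧_ Sa e)

  nbr-outside : ∀ S a v → nbr G S v ≡ false → adj a v ≡ true → S a ≡ false
  nbr-outside S a v outside e = contraposition (λ Sa → nbr-witness S a v Sa e) outside

  nbr-mono : ∀ {S S'} → S ⊆ S' → nbr G S ⊆ nbr G S'
  nbr-mono {S} {S'} S⊆S' v = anyF-mono widen
    where
    widen : ∀ a → (S a ∧ adj a v) ≡ true → (S' a ∧ adj a v) ≡ true
    widen a p = cong₂ _∧_ (S⊆S' a (∧-conicalˡ _ _ p)) (∧-conicalʳ _ _ p)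

  nbr-cong : ∀ {S S'} → S ≐ S' → nbr G S ≐ nbr G S'
  nbr-cong S≐S' v = anyF-cong (λ a → cong (_∧ adj a v) (S≐S' a))

  -- A check set is dense if every variable it touches has at least two
  -- neighbours in it.  This is the defining condition of CoreLike G full full.
  Dense : FSet m → Set
  Dense C = ∀ v → nbr G C v ≡ true → 2 ≤ vdeg G C full v

  lowVar-false : ∀ F V v → (V v ≡ true → 2 ≤ vdeg G F V v) → lowVar G F V v ≡ false
  lowVar-false F V v deg with V v
  ... | false = refl
  ... | true  = ≤ᵇ1-false (deg refl)

  peelStep-keeps : ∀ F V a → F a ≡ true →
    (∀ v → adj a v ≡ true → V v ≡ true → 2 ≤ vdeg G F V v) →
    proj₁ (peelStep G (F , V)) a ≡ true
  peelStep-keeps F V a Fa deg =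
    cong₂ (λ x y → x ∧ not y) Fa (anyF-empty (λ v → lowVar G F V v ∧ adj a v) noLowNeighbour)
    where
    noLowNeighbour : ∀ v → (lowVar G F V v ∧ adj a v) ≡ false
    noLowNeighbour v with adj a v in e
    ... | false = ∧-zeroʳ _
    ... | true  = cong (_∧ true) (lowVar-false F V v (deg v e))

  peeling-shrinks : ∀ F V t → proj₂ (iter (peelStep G) t (F , V)) ⊆ V
  peeling-shrinks F V zero    v p = p
  peeling-shrinks F V (suc t) v p = peeling-shrinks F V t v (∧-conicalˡ _ _ p)

  peeling-keeps-dense : ∀ F0 V0 → (∀ v b → V0 v ≡ true → adj b v ≡ true → F0 b ≡ true) →
    ∀ C → Dense C → ∀ t a → C a ≡ true → F0 a ≡ true →
    proj₁ (iter (peelStep G) t (F0 , V0)) a ≡ true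
  peeling-keeps-dense F0 V0 closed C dense zero    a Ca F0a = F0a
  peeling-keeps-dense F0 V0 closed C dense (suc t) a Ca F0a =
    peelStep-keeps Ft Vt a (survives a Ca F0a) degree≥2
    where
    Ft : FSet m
    Ft = proj₁ (iter (peelStep G) t (F0 , V0))
    Vt : FSet n
    Vt = proj₂ (iter (peelStep G) t (F0 , V0))
    survives : ∀ b → C b ≡ true → F0 b ≡ true → Ft b ≡ true
    survives = peeling-keeps-dense F0 V0 closed C dense t
    -- every C-neighbour of a remaining variable is still present
    degree≥2 : ∀ v → adj a v ≡ true → Vt v ≡ true → 2 ≤ vdeg G Ft Vt v
    degree≥2 v e Vtv = ≤-trans (dense v (nbr-witness C a v Ca e)) (count-mono present)
      where
      present : ∀ b → (C b ∧ adj b v) ≡ true → (Ft b ∧ adj b v) ≡ true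
      present b p = cong₂ _∧_
        (survives b Cb (closed v b (peeling-shrinks F0 V0 t v Vtv) (∧-conicalʳ _ _ p)))
        (∧-conicalʳ _ _ p)
        where
        Cb : C b ≡ true
        Cb = ∧-conicalˡ _ _ p

  peelable-avoids-dense : ∀ F0 V0 → (∀ v b → V0 v ≡ true → adj b v ≡ true → F0 b ≡ true) →
    Peelable G F0 V0 → ∀ C → Dense C → ∀ a → C a ≡ true → F0 a ≡ false
  peelable-avoids-dense F0 V0 closed (t , noChecksLeft , _) C dense a Ca =
    contraposition (peeling-keeps-dense F0 V0 closed C dense t a Ca) (noChecksLeft a)

  complement-closed : ∀ Fs v b → not (nbr G Fs v) ≡ true → adj b v ≡ true → not (Fs b) ≡ true
  complement-closed Fs v b outside e = cong not (nbr-outside Fs b v (not-injective outside) e)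

  dense-inside : ∀ Fs → Peelable G (not ∘ Fs) (not ∘ nbr G Fs) → ∀ C → Dense C → C ⊆ Fs
  dense-inside Fs peelable C dense a Ca =
    not-injective (peelable-avoids-dense _ _ (complement-closed Fs) peelable C dense a Ca)

  coreLike-restrict : ∀ Fs C → C ⊆ Fs → Dense C → CoreLike G Fs (nbr G Fs) C
  coreLike-restrict Fs C C⊆Fs dense = C⊆Fs , λ v p → dense v (∧-conicalʳ _ _ p)

  coreLike-extend : ∀ Fs C → CoreLike G Fs (nbr G Fs) C → CoreLike G full full C
  coreLike-extend Fs C (C⊆Fs , dense) =
    (λ _ _ → refl) , λ v p → dense v (cong₂ _∧_ (nbr-mono C⊆Fs v p) p)

  twoCore-lift : ∀ Fs C → (∀ C' → Dense C' → C' ⊆ Fs) →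
    IsTwoCore G Fs (nbr G Fs) C → IsTwoCore G full full C
  twoCore-lift Fs C inside (core , maximal) =
    coreLike-extend Fs C core ,
    λ C' (_ , dense') C⊆C' → maximal C' (coreLike-restrict Fs C' (inside C' dense') dense') C⊆C'

  eligible-cong : ∀ Fs Vs {S S'} → S ≐ S' → eligible G Fs Vs S ≐ eligible G Fs Vs S'
  eligible-cong Fs Vs S≐S' a =
    cong₂ (λ x c → Fs a ∧ not x ∧ (c ≤ᵇ 1)) (S≐S' a)
      (count-cong (λ v → cong (λ y → Vs v ∧ adj a v ∧ not (Vs v ∧ y)) (nbr-cong S≐S' v)))

  augStep-within : ∀ Fs Vs S → S ⊆ Fs → augStep G Fs Vs S ⊆ Fs
  augStep-within Fs Vs S S⊆Fs a p with S a in Sa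
  ... | true  = S⊆Fs a Sa
  ... | false = ∧-conicalˡ _ _ p

  augment-within : ∀ Fs Vs S → S ⊆ Fs → ∀ t → iter (augStep G Fs Vs) t S ⊆ Fs
  augment-within Fs Vs S S⊆Fs zero    = S⊆Fs
  augment-within Fs Vs S S⊆Fs (suc t) =
    augStep-within Fs Vs _ (augment-within Fs Vs S S⊆Fs t)

  saturated : ∀ Fs Vs a → eligible G Fs Vs Fs a ≡ false
  saturated Fs Vs a with Fs a
  ... | true  = refl
  ... | false = refl

  Spread : FSet m → Set
  Spread Fs = ∀ a → not (Fs a) ≡ true → 2 ≤ count (λ v → not (nbr G Fs v) ∧ adj a v)

  eligible-agree : ∀ Fs → Spread Fs → ∀ S → S ⊆ Fs →
    eligible G full full S ≐ eligible G Fs (nbr G Fs) S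
  eligible-agree Fs spread S S⊆Fs a with Fs a in Fsa
  ... | true  = cong (λ c → not (S a) ∧ (c ≤ᵇ 1)) (count-cong sameOutside)
    where
    -- all neighbours of a lie in nbr Fs
    sameOutside : ∀ v → (adj a v ∧ not (nbr G S v))
                      ≡ (nbr G Fs v ∧ adj a v ∧ not (nbr G Fs v ∧ nbr G S v))
    sameOutside v with adj a v in e
    ... | false = sym (∧-zeroʳ (nbr G Fs v))
    ... | true  rewrite nbr-witness Fs a v Fsa e = refl
  ... | false rewrite contraposition (S⊆Fs a) Fsa =
    ≤ᵇ1-false (≤-trans (spread a (cong not Fsa)) (count-mono outsideS))
    where
    -- a neighbour outside nbr Fs is in particular outside nbr S
    outsideS : ∀ v → (not (nbr G Fs v) ∧ adj a v) ≡ true → (adj a v ∧ not (nbr G S v)) ≡ true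
    outsideS v p = cong₂ _∧_ (∧-conicalʳ _ _ p)
      (cong not (contraposition (nbr-mono S⊆Fs v) (not-injective (∧-conicalˡ _ _ p))))

  augment-agree : ∀ Fs → Spread Fs → ∀ S → S ⊆ Fs → ∀ t →
    iter (augStep G full full) t S ≐ iter (augStep G Fs (nbr G Fs)) t S
  augment-agree Fs spread S S⊆Fs zero    a = refl
  augment-agree Fs spread S S⊆Fs (suc t) a = begin
      T a ∨ eligible G full full T a
    ≡⟨ cong₂ _∨_ (ih a) (eligible-cong full full ih a) ⟩
      U a ∨ eligible G full full U a
    ≡⟨ cong (U a ∨_) (eligible-agree Fs spread U (augment-within Fs (nbr G Fs) S S⊆Fs t) a) ⟩
      U a ∨ eligible G Fs (nbr G Fs) U a
    ∎
    where
    open ≡-Reasoning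
    T U : FSet m
    T = iter (augStep G full full) t S
    U = iter (augStep G Fs (nbr G Fs)) t S
    ih : T ≐ U
    ih = augment-agree Fs spread S S⊆Fs t

lemma6p3 : ∀ {n k m} (G : FactorGraph n k m) (Fb : FSet m) →
    Peelable G (not ∘ Fb) (not ∘ nbr G Fb) →
    Rigid G Fb (nbr G Fb) →
    (∀ a → not (Fb a) ≡ true →
      2 ≤ count (λ v → not (nbr G Fb v) ∧ FactorGraph.adj G a v)) →
    IsBackbone G full full Fb (nbr G Fb)
lemma6p3 G Fb peelable (C , B , twoCore , (t , reachesB , _) , B≐Fb , _) spread =
  C , Fb , twoCore-lift G Fb C (dense-inside G Fb peelable) twoCore ,
  (t , reachesFb , nothingEligible) , (λ _ → refl) , (λ _ → refl)
  where
  C⊆Fb : C ⊆ Fb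
  C⊆Fb = proj₁ (proj₁ twoCore)
  reachesFb : iter (augStep G full full) t C ≐ Fb
  reachesFb a = trans (augment-agree G Fb spread C C⊆Fb t a) (trans (reachesB a) (B≐Fb a))
  nothingEligible : ∀ a → eligible G full full Fb a ≡ false
  nothingEligible a =
    trans (eligible-agree G Fb spread Fb (λ _ p → p) a) (saturated G Fb (nbr G Fb) a)
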